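{- Let \(S(\eta)\) be an n-clause set and \(j \geq 0\). Then \(\forall x\,\forall y\,(\mathsf{s}x = \mathsf{s}y \rightarrow x = y),\ S(\eta) \vdash S{\downarrow_{j}}(\mathsf{s}^{j}\eta)\).
   Context: We work in many-sorted classical first-order logic with a sort \(\mathrm{nat}\) of natural numbers, with function symbols \(\mathsf{0} : \mathrm{nat}\) and \(\mathsf{s} : \mathrm{nat} \to \mathrm{nat}\). The language contains at least one further sort besides \(\mathrm{nat}\) and no function symbols of range \(\mathrm{nat}\) other than \(\mathsf{0}\) and \(\mathsf{s}\). \(\eta\) is a distinguished free variable of sort \(\mathrm{nat}\) (the parameter); \(\mathsf{s}^{i}t\) denotes \(i\)-fold application of \(\mathsf{s}\) to \(t\). An n-clause is a clause of the form \(\forall \vec{x}\,(N(\eta,\vec{x}) \vee C(\vec{x}))\), where \(N\) is a disjunction of literals \(\eta \neq t(\vec{x})\) and \(C\) is a disjunction of literals \(t \bowtie s\) with \(\bowtie \in \{=,\neq\}\) and \(t,s\) terms of sort other than \(\mathrm{nat}\); an n-clause set is a conjunction of n-clauses. For an n-clause \(\mathcal{C} = \forall \vec{x}\,(N \vee C)\) with \(N = \bigvee_{l=1}^{k} \eta \neq t_{l}\), \(\mathcal{C}{\downarrow_{i}} := \forall \vec{x}\,(\bigvee_{l=1}^{k} \eta \neq \mathsf{s}^{i}(t_{l}) \vee C)\); for an n-clause set \(S = \bigwedge_{l} \mathcal{C}_{l}\), \(S{\downarrow_{i}} := \bigwedge_{l} \mathcal{C}_{l}{\downarrow_{i}}\).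 -}

module Defs where

open import Data.List using (List; []; _∷_; _++_; map)
open import Data.List.Membership.Propositional using (_∈_)
open import Data.Nat using (ℕ; zero; suc)

data Sort (O : Set) : Set where
  nat   : Sort O
  other : O → Sort O

-- The only function symbols of range nat are 0 and s
-- (built into the term syntax below); every other function symbol has a
-- range among the other sorts.
record Signature : Set₁ where
  field
    OSort    : Set
    someSort : OSort
    Fun      : List (Sort OSort) → OSort → Set
    Pred     : List (Sort OSort) → Set

module FOL (L : Signature) where
  open Signature L

  Srt : Set
  Srt = Sort OSort

  Ctx : Set
  Ctx = List Srt

  -- de Bruijn variables (here = innermost)
  data _∋_ : Ctx → Srt → Set where
    here  : ∀ {Γ σ} → (σ ∷ Γ) ∋ σ
    there : ∀ {Γ σ τ} → Γ ∋ σ → (τ ∷ Γ) ∋ σ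

  mutual
    data Term (Γ : Ctx) : Srt → Set where
      var  : ∀ {σ} → Γ ∋ σ → Term Γ σ
      zeroT : Term Γ nat
      sucT : Term Γ nat → Term Γ nat
      app  : ∀ {σs o} → Fun σs o → Terms Γ σs → Term Γ (other o)

    data Terms (Γ : Ctx) : List Srt → Set where
      []  : Terms Γ []
      _∷_ : ∀ {σ σs} → Term Γ σ → Terms Γ σs → Terms Γ (σ ∷ σs)

  sucⁿ : ∀ {Γ} → ℕ → Term Γ nat → Term Γ nat
  sucⁿ zero    t = t
  sucⁿ (suc i) t = sucT (sucⁿ i t)

  Ren : Ctx → Ctx → Set
  Ren Γ Δ = ∀ {σ} → Γ ∋ σ → Δ ∋ σ

  extR : ∀ {Γ Δ τ} → Ren Γ Δ → Ren (τ ∷ Γ) (τ ∷ Δ)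
  extR ρ here      = here
  extR ρ (there x) = there (ρ x)

  mutual
    ren : ∀ {Γ Δ σ} → Ren Γ Δ → Term Γ σ → Term Δ σ
    ren ρ (var x)    = var (ρ x)
    ren ρ zeroT      = zeroT
    ren ρ (sucT t)   = sucT (ren ρ t)
    ren ρ (app f ts) = app f (rens ρ ts)

    rens : ∀ {Γ Δ σs} → Ren Γ Δ → Terms Γ σs → Terms Δ σs
    rens ρ []       = []
    rens ρ (t ∷ ts) = ren ρ t ∷ rens ρ ts

  Sub : Ctx → Ctx → Set
  Sub Γ Δ = ∀ {σ} → Γ ∋ σ → Term Δ σ

  extS : ∀ {Γ Δ τ} → Sub Γ Δ → Sub (τ ∷ Γ) (τ ∷ Δ)
  extS s here      = var here
  extS s (there x) = ren there (s x)

  mutual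
    sub : ∀ {Γ Δ σ} → Sub Γ Δ → Term Γ σ → Term Δ σ
    sub s (var x)    = s x
    sub s zeroT      = zeroT
    sub s (sucT t)   = sucT (sub s t)
    sub s (app f ts) = app f (subs s ts)

    subs : ∀ {Γ Δ σs} → Sub Γ Δ → Terms Γ σs → Terms Δ σs
    subs s []       = []
    subs s (t ∷ ts) = sub s t ∷ subs s ts

  infix  7 _≐_
  infixr 6 _∧_
  infixr 5 _∨_
  infixr 4 _⇒_

  data Formula (Γ : Ctx) : Set where
    ⊥'   : Formula Γ
    ⊤'   : Formula Γ
    _≐_  : ∀ {σ} → Term Γ σ → Term Γ σ → Formula Γ
    pred : ∀ {σs} → Pred σs → Terms Γ σs → Formula Γ
    _⇒_  : Formula Γ → Formula Γ → Formula Γ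
    _∧_  : Formula Γ → Formula Γ → Formula Γ
    _∨_  : Formula Γ → Formula Γ → Formula Γ
    all  : (σ : Srt) → Formula (σ ∷ Γ) → Formula Γ
    ex   : (σ : Srt) → Formula (σ ∷ Γ) → Formula Γ

  ¬' : ∀ {Γ} → Formula Γ → Formula Γ
  ¬' φ = φ ⇒ ⊥'

  renF : ∀ {Γ Δ} → Ren Γ Δ → Formula Γ → Formula Δ
  renF ρ ⊥'          = ⊥'
  renF ρ ⊤'          = ⊤'
  renF ρ (t ≐ u)     = ren ρ t ≐ ren ρ u
  renF ρ (pred P ts) = pred P (rens ρ ts)
  renF ρ (φ ⇒ ψ)     = renF ρ φ ⇒ renF ρ ψ
  renF ρ (φ ∧ ψ)     = renF ρ φ ∧ renF ρ ψ
  renF ρ (φ ∨ ψ)     = renF ρ φ ∨ renF ρ ψ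
  renF ρ (all σ φ)   = all σ (renF (extR ρ) φ)
  renF ρ (ex σ φ)    = ex σ (renF (extR ρ) φ)

  subF : ∀ {Γ Δ} → Sub Γ Δ → Formula Γ → Formula Δ
  subF s ⊥'          = ⊥'
  subF s ⊤'          = ⊤'
  subF s (t ≐ u)     = sub s t ≐ sub s u
  subF s (pred P ts) = pred P (subs s ts)
  subF s (φ ⇒ ψ)     = subF s φ ⇒ subF s ψ
  subF s (φ ∧ ψ)     = subF s φ ∧ subF s ψ
  subF s (φ ∨ ψ)     = subF s φ ∨ subF s ψ
  subF s (all σ φ)   = all σ (subF (extS s) φ)
  subF s (ex σ φ)    = ex σ (subF (extS s) φ)

  wkF : ∀ {Γ τ} → Formula Γ → Formula (τ ∷ Γ)
  wkF = renF there

  sub₀ : ∀ {Γ σ} → Term Γ σ → Sub (σ ∷ Γ) Γ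
  sub₀ t here      = t
  sub₀ t (there x) = var x

  _[_] : ∀ {Γ σ} → Formula (σ ∷ Γ) → Term Γ σ → Formula Γ
  φ [ t ] = subF (sub₀ t) φ

  infix 2 _⊢_
  data _⊢_ : ∀ {Γ} → List (Formula Γ) → Formula Γ → Set where
    hyp   : ∀ {Γ} {Hs : List (Formula Γ)} {φ} → φ ∈ Hs → Hs ⊢ φ
    ⊤I    : ∀ {Γ} {Hs : List (Formula Γ)} → Hs ⊢ ⊤'
    ⊥E    : ∀ {Γ} {Hs : List (Formula Γ)} {φ} → Hs ⊢ ⊥' → Hs ⊢ φ
    raa   : ∀ {Γ} {Hs : List (Formula Γ)} {φ} → (¬' φ ∷ Hs) ⊢ ⊥' → Hs ⊢ φ
    ⇒I    : ∀ {Γ} {Hs : List (Formula Γ)} {φ ψ} → (φ ∷ Hs) ⊢ ψ → Hs ⊢ φ ⇒ ψ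
    ⇒E    : ∀ {Γ} {Hs : List (Formula Γ)} {φ ψ} → Hs ⊢ φ ⇒ ψ → Hs ⊢ φ → Hs ⊢ ψ
    ∧I    : ∀ {Γ} {Hs : List (Formula Γ)} {φ ψ} → Hs ⊢ φ → Hs ⊢ ψ → Hs ⊢ φ ∧ ψ
    ∧E₁   : ∀ {Γ} {Hs : List (Formula Γ)} {φ ψ} → Hs ⊢ φ ∧ ψ → Hs ⊢ φ
    ∧E₂   : ∀ {Γ} {Hs : List (Formula Γ)} {φ ψ} → Hs ⊢ φ ∧ ψ → Hs ⊢ ψ
    ∨I₁   : ∀ {Γ} {Hs : List (Formula Γ)} {φ ψ} → Hs ⊢ φ → Hs ⊢ φ ∨ ψ
    ∨I₂   : ∀ {Γ} {Hs : List (Formula Γ)} {φ ψ} → Hs ⊢ ψ → Hs ⊢ φ ∨ ψ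
    ∨E    : ∀ {Γ} {Hs : List (Formula Γ)} {φ ψ χ} → Hs ⊢ φ ∨ ψ →
              (φ ∷ Hs) ⊢ χ → (ψ ∷ Hs) ⊢ χ → Hs ⊢ χ
    ∀I    : ∀ {Γ} {Hs : List (Formula Γ)} {σ} {φ : Formula (σ ∷ Γ)} →
              map wkF Hs ⊢ φ → Hs ⊢ all σ φ
    ∀E    : ∀ {Γ} {Hs : List (Formula Γ)} {σ} {φ : Formula (σ ∷ Γ)} →
              Hs ⊢ all σ φ → (t : Term Γ σ) → Hs ⊢ φ [ t ]
    ∃I    : ∀ {Γ} {Hs : List (Formula Γ)} {σ} {φ : Formula (σ ∷ Γ)} →
              (t : Term Γ σ) → Hs ⊢ φ [ t ] → Hs ⊢ ex σ φ
    ∃E    : ∀ {Γ} {Hs : List (Formula Γ)} {σ} {φ : Formula (σ ∷ Γ)} {ψ} →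
              Hs ⊢ ex σ φ → (φ ∷ map wkF Hs) ⊢ wkF ψ → Hs ⊢ ψ
    ≐refl : ∀ {Γ} {Hs : List (Formula Γ)} {σ} (t : Term Γ σ) → Hs ⊢ t ≐ t
    ≐subst : ∀ {Γ} {Hs : List (Formula Γ)} {σ} (φ : Formula (σ ∷ Γ)) {t u : Term Γ σ} →
              Hs ⊢ t ≐ u → Hs ⊢ φ [ t ] → Hs ⊢ φ [ u ]

  data Lit (Δ : Ctx) : Set where
    eqL  : ∀ {o} → Term Δ (other o) → Term Δ (other o) → Lit Δ
    neqL : ∀ {o} → Term Δ (other o) → Term Δ (other o) → Lit Δ

  -- An n-clause  ∀ x⃗ (⋁_l η ≠ t_l(x⃗) ∨ C(x⃗)); the terms t_l and the
  -- literals of C only mention the bound variables x⃗ (not η).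
  record NClause : Set where
    field
      vars  : Ctx                      -- sorts of the bound variables x⃗
      nlits : List (Term vars nat)
      clits : List (Lit vars)

  NClauseSet : Set
  NClauseSet = List NClause

  ηCtx : Ctx
  ηCtx = nat ∷ []

  η : Term ηCtx nat
  η = var here

  inl : ∀ {Γ σ} (Δ : Ctx) → Δ ∋ σ → (Δ ++ Γ) ∋ σ
  inl (_ ∷ Δ) here      = here
  inl (_ ∷ Δ) (there x) = there (inl Δ x)

  inr : ∀ {Γ σ} (Δ : Ctx) → Γ ∋ σ → (Δ ++ Γ) ∋ σ
  inr []      x = x
  inr (_ ∷ Δ) x = there (inr Δ x)

  ∀* : ∀ {Γ} (Δ : Ctx) → Formula (Δ ++ Γ) → Formula Γ
  ∀* []      φ = φ
  ∀* (σ ∷ Δ) φ = ∀* Δ (all σ φ)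

  ⋁ : ∀ {Γ} → List (Formula Γ) → Formula Γ
  ⋁ []       = ⊥'
  ⋁ (φ ∷ φs) = φ ∨ ⋁ φs

  ⋀ : ∀ {Γ} → List (Formula Γ) → Formula Γ
  ⋀ []       = ⊤'
  ⋀ (φ ∷ φs) = φ ∧ ⋀ φs

  litF : ∀ {Γ} (Δ : Ctx) → Lit Δ → Formula (Δ ++ Γ)
  litF Δ (eqL t u)  = ren (inl Δ) t ≐ ren (inl Δ) u
  litF Δ (neqL t u) = ¬' (ren (inl Δ) t ≐ ren (inl Δ) u)

  clauseF : NClause → Formula ηCtx
  clauseF c = ∀* vars
      (⋁ (map (λ t → ¬' (var (inr vars here) ≐ ren (inl vars) t)) nlits
          ++ map (litF vars) clits))
    where open NClause c

  setF : NClauseSet → Formula ηCtx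
  setF S = ⋀ (map clauseF S)

  _↓_ : NClause → ℕ → NClause
  c ↓ i = record { vars = vars ; nlits = map (sucⁿ i) nlits ; clits = clits }
    where open NClause c

  _↓ₛ_ : NClauseSet → ℕ → NClauseSet
  S ↓ₛ i = map (_↓ i) S

  _⟨_⟩ : Formula ηCtx → Term ηCtx nat → Formula ηCtx
  φ ⟨ t ⟩ = subF (λ { here → t }) φ

  sInj : Formula ηCtx
  sInj = all nat (all nat
           (sucT (var (there here)) ≐ sucT (var here) ⇒ var (there here) ≐ var here))

module Submission where

-- Substituting sʲη for η leaves the part C of an n-clause unchanged, as C does not mention η,
-- and turns each literal η ≠ t into sʲη ≠ sʲt, which follows from η ≠ t by cancelling s
-- j times with the injectivity axiom.  The entailment is thus checked literal by literal and
-- lifted through the disjunction, the quantifier prefix and the conjunction over the clauses.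

open import Defs
open import Data.List using (List; []; _∷_; _++_; map)
open import Data.List.Membership.Propositional using (_∈_)
open import Data.List.Properties using (map-∘)
open import Data.List.Relation.Binary.Pointwise using (Pointwise; []; _∷_; ++⁺; map⁺)
  renaming (refl to Pointwise-refl)
open import Data.List.Relation.Binary.Subset.Propositional using (_⊆_)
import Data.List.Relation.Binary.Subset.Propositional.Properties as ⊆
open import Data.List.Relation.Unary.Any using (here; there)
open import Data.Nat using (ℕ; zero; suc)
open import Function using (_∘_)
open import Relation.Binary.PropositionalEquality
  using (_≡_; refl; sym; trans; cong; cong₂; subst; module ≡-Reasoning)

module _ (L : Signature) where
  open FOL L

  private
    variable
      Γ Δ Θ : Ctx
      σ σ′ : Srt
      φ ψ : Formula Γ
      Hs Ks : List (Formula Γ)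
      j : ℕ

  ⊢-weaken : Hs ⊆ Ks → Hs ⊢ φ → Ks ⊢ φ
  ⊢-weaken w (hyp m) = hyp (w m)
  ⊢-weaken w ⊤I = ⊤I
  ⊢-weaken w (⊥E d) = ⊥E (⊢-weaken w d)
  ⊢-weaken w (raa d) = raa (⊢-weaken (⊆.∷⁺ʳ _ w) d)
  ⊢-weaken w (⇒I d) = ⇒I (⊢-weaken (⊆.∷⁺ʳ _ w) d)
  ⊢-weaken w (⇒E d e) = ⇒E (⊢-weaken w d) (⊢-weaken w e)
  ⊢-weaken w (∧I d e) = ∧I (⊢-weaken w d) (⊢-weaken w e)
  ⊢-weaken w (∧E₁ d) = ∧E₁ (⊢-weaken w d)
  ⊢-weaken w (∧E₂ d) = ∧E₂ (⊢-weaken w d)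
  ⊢-weaken w (∨I₁ d) = ∨I₁ (⊢-weaken w d)
  ⊢-weaken w (∨I₂ d) = ∨I₂ (⊢-weaken w d)
  ⊢-weaken w (∨E d e f) =
    ∨E (⊢-weaken w d) (⊢-weaken (⊆.∷⁺ʳ _ w) e) (⊢-weaken (⊆.∷⁺ʳ _ w) f)
  ⊢-weaken w (∀I d) = ∀I (⊢-weaken (⊆.map⁺ wkF w) d)
  ⊢-weaken w (∀E d t) = ∀E (⊢-weaken w d) t
  ⊢-weaken w (∃I t d) = ∃I t (⊢-weaken w d)
  ⊢-weaken w (∃E d e) = ∃E (⊢-weaken w d) (⊢-weaken (⊆.∷⁺ʳ _ (⊆.map⁺ wkF w)) e)
  ⊢-weaken w (≐refl t) = ≐refl t
  ⊢-weaken w (≐subst χ d e) = ≐subst χ (⊢-weaken w d) (⊢-weaken w e)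

  IsIdRen : Ren Γ Γ → Set
  IsIdRen {Γ = Γ} ρ = ∀ {τ} (x : Γ ∋ τ) → ρ x ≡ x

  _∘ʳ_≗ʳ_ : Sub Δ Θ → Ren Γ Δ → Ren Γ Θ → Set
  _∘ʳ_≗ʳ_ {Γ = Γ} s ρ ρ′ = ∀ {τ} (x : Γ ∋ τ) → s (ρ x) ≡ var (ρ′ x)

  module _ {ρ : Ren Γ Γ} (h : IsIdRen ρ) where
    mutual
      ren-id : (t : Term Γ σ) → ren ρ t ≡ t
      ren-id (var x)    = cong var (h x)
      ren-id zeroT      = refl
      ren-id (sucT t)   = cong sucT (ren-id t)
      ren-id (app f ts) = cong (app f) (rens-id ts)

      rens-id : ∀ {σs} (ts : Terms Γ σs) → rens ρ ts ≡ ts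
      rens-id []       = refl
      rens-id (t ∷ ts) = cong₂ _∷_ (ren-id t) (rens-id ts)

    extR-id : IsIdRen (extR {τ = σ} ρ)
    extR-id here      = refl
    extR-id (there x) = cong there (h x)

  renF-id : {ρ : Ren Γ Γ} → IsIdRen ρ → (φ : Formula Γ) → renF ρ φ ≡ φ
  renF-id h ⊥'          = refl
  renF-id h ⊤'          = refl
  renF-id h (t ≐ u)     = cong₂ _≐_ (ren-id h t) (ren-id h u)
  renF-id h (pred P ts) = cong (pred P) (rens-id h ts)
  renF-id h (φ ⇒ ψ)     = cong₂ _⇒_ (renF-id h φ) (renF-id h ψ)
  renF-id h (φ ∧ ψ)     = cong₂ _∧_ (renF-id h φ) (renF-id h ψ)
  renF-id h (φ ∨ ψ)     = cong₂ _∨_ (renF-id h φ) (renF-id h ψ)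
  renF-id h (all σ φ)   = cong (all σ) (renF-id (extR-id h) φ)
  renF-id h (ex σ φ)    = cong (ex σ) (renF-id (extR-id h) φ)

  module _ {s : Sub Δ Θ} {ρ : Ren Γ Δ} {ρ′ : Ren Γ Θ} (h : s ∘ʳ ρ ≗ʳ ρ′) where
    mutual
      sub-ren : (t : Term Γ σ) → sub s (ren ρ t) ≡ ren ρ′ t
      sub-ren (var x)    = h x
      sub-ren zeroT      = refl
      sub-ren (sucT t)   = cong sucT (sub-ren t)
      sub-ren (app f ts) = cong (app f) (subs-rens ts)

      subs-rens : ∀ {σs} (ts : Terms Γ σs) → subs s (rens ρ ts) ≡ rens ρ′ ts
      subs-rens []       = refl
      subs-rens (t ∷ ts) = cong₂ _∷_ (sub-ren t) (subs-rens ts)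

    extS-extR : extS {τ = σ} s ∘ʳ extR ρ ≗ʳ extR ρ′
    extS-extR here      = refl
    extS-extR (there x) = cong (ren there) (h x)

  subF-renF : {s : Sub Δ Θ} {ρ : Ren Γ Δ} {ρ′ : Ren Γ Θ} → s ∘ʳ ρ ≗ʳ ρ′ →
              (φ : Formula Γ) → subF s (renF ρ φ) ≡ renF ρ′ φ
  subF-renF h ⊥'          = refl
  subF-renF h ⊤'          = refl
  subF-renF h (t ≐ u)     = cong₂ _≐_ (sub-ren h t) (sub-ren h u)
  subF-renF h (pred P ts) = cong (pred P) (subs-rens h ts)
  subF-renF h (φ ⇒ ψ)     = cong₂ _⇒_ (subF-renF h φ) (subF-renF h ψ)
  subF-renF h (φ ∧ ψ)     = cong₂ _∧_ (subF-renF h φ) (subF-renF h ψ)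
  subF-renF h (φ ∨ ψ)     = cong₂ _∨_ (subF-renF h φ) (subF-renF h ψ)
  subF-renF h (all σ φ)   = cong (all σ) (subF-renF (extS-extR h) φ)
  subF-renF h (ex σ φ)    = cong (ex σ) (subF-renF (extS-extR h) φ)

  sub₀-wk : (u : Term Γ σ) (t : Term Γ σ′) → sub (sub₀ u) (ren there t) ≡ t
  sub₀-wk u t = trans (sub-ren {ρ′ = λ x → x} (λ x → refl) t) (ren-id (λ x → refl) t)

  wk-binder-[here] : (φ : Formula (σ ∷ Γ)) → renF (extR there) φ [ var here ] ≡ φ
  wk-binder-[here] φ = trans (subF-renF var-here φ) (renF-id (λ x → refl) φ)
    where
      var-here : sub₀ (var here) ∘ʳ extR there ≗ʳ (λ x → x)
      var-here here      = refl
      var-here (there x) = refl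

  ren-sucⁿ : (ρ : Ren Γ Δ) (j : ℕ) (t : Term Γ nat) →
             ren ρ (sucⁿ j t) ≡ sucⁿ j (ren ρ t)
  ren-sucⁿ ρ zero    t = refl
  ren-sucⁿ ρ (suc j) t = cong sucT (ren-sucⁿ ρ j t)

  extS* : (Δ : Ctx) → Sub Γ Θ → Sub (Δ ++ Γ) (Δ ++ Θ)
  extS* []      s = s
  extS* (τ ∷ Δ) s = extS (extS* Δ s)

  subF-∀* : (Δ : Ctx) (s : Sub Γ Θ) (φ : Formula (Δ ++ Γ)) →
            subF s (∀* Δ φ) ≡ ∀* Δ (subF (extS* Δ s) φ)
  subF-∀* []      s φ = refl
  subF-∀* (τ ∷ Δ) s φ = subF-∀* Δ s (all τ φ)

  extS*-inl : (Δ : Ctx) (s : Sub Γ Θ) → extS* Δ s ∘ʳ inl Δ ≗ʳ inl Δ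
  extS*-inl (σ ∷ Δ) s here      = refl
  extS*-inl (σ ∷ Δ) s (there x) = cong (ren there) (extS*-inl Δ s x)

  sub-extS*-inl : (Δ : Ctx) (s : Sub Γ Θ) (t : Term Δ σ) →
                  sub (extS* Δ s) (ren (inl Δ) t) ≡ ren (inl Δ) t
  sub-extS*-inl Δ s = sub-ren (extS*-inl Δ s)

  -- The substitution in _⟨_⟩ is a pattern lambda, so we work with any s that agrees with it.
  extS*-inr-η : (Δ : Ctx) (s : Sub ηCtx ηCtx) → s here ≡ sucⁿ j η →
                extS* Δ s (inr Δ here) ≡ sucⁿ j (var (inr Δ here))
  extS*-inr-η []      s sh = sh
  extS*-inr-η {j = j} (τ ∷ Δ) s sh = begin
    ren there (extS* Δ s (inr Δ here))    ≡⟨ cong (ren there) (extS*-inr-η Δ s sh) ⟩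
    ren there (sucⁿ j (var (inr Δ here))) ≡⟨ ren-sucⁿ there j (var (inr Δ here)) ⟩
    sucⁿ j (var (there (inr Δ here)))     ∎
    where open ≡-Reasoning

  -- sInj in an arbitrary context; being closed, wkF sInj′ reduces to sInj′.
  sInj′ : Formula Γ
  sInj′ = all nat (all nat
            (sucT (var (there here)) ≐ sucT (var here) ⇒ var (there here) ≐ var here))

  ⊢-suc-cancel : {a b : Term Γ nat} → sInj′ ∈ Hs → Hs ⊢ sucT a ≐ sucT b → Hs ⊢ a ≐ b
  ⊢-suc-cancel {Hs = Hs} {a} {b} m d =
    subst (λ t → Hs ⊢ t ≐ b) (sub₀-wk b a) (⇒E instance-ab d′)
    where
      a′ : Term _ nat
      a′ = sub (sub₀ b) (ren there a)

      instance-ab : Hs ⊢ sucT a′ ≐ sucT b ⇒ a′ ≐ b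
      instance-ab = ∀E (∀E (hyp m) a) b

      d′ : Hs ⊢ sucT a′ ≐ sucT b
      d′ = subst (λ t → Hs ⊢ sucT t ≐ sucT b) (sym (sub₀-wk b a)) d

  ⊢-sucⁿ-cancel : (j : ℕ) {a b : Term Γ nat} →
                  sInj′ ∈ Hs → Hs ⊢ sucⁿ j a ≐ sucⁿ j b → Hs ⊢ a ≐ b
  ⊢-sucⁿ-cancel zero    m d = d
  ⊢-sucⁿ-cancel (suc j) m d = ⊢-sucⁿ-cancel j m (⊢-suc-cancel m d)

  infix 3 _⊩_ _⊩[_]_

  _⊩_ : Formula Γ → Formula Γ → Set
  φ ⊩ ψ = ∀ {Hs} → sInj′ ∈ Hs → Hs ⊢ φ → Hs ⊢ ψ

  _⊩[_]_ : Formula Θ → Sub Γ Θ → Formula Γ → Set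
  φ ⊩[ s ] ψ = φ ⊩ subF s ψ

  ⊩-reflexive : φ ≡ ψ → φ ⊩ ψ
  ⊩-reflexive refl m d = d

  ⊩[]-map⁺ : {A : Set} {s : Sub Γ Θ} (f : A → Formula Θ) (g : A → Formula Γ) →
             (∀ a → f a ⊩[ s ] g a) →
             (as : List A) → Pointwise _⊩[ s ]_ (map f as) (map g as)
  ⊩[]-map⁺ f g h as = map⁺ f g (Pointwise-refl λ {a} {Hs} → h a {Hs})

  ≢-sucⁿ : (j : ℕ) {a b : Term Γ nat} → ¬' (a ≐ b) ⊩ ¬' (sucⁿ j a ≐ sucⁿ j b)
  ≢-sucⁿ j m d = ⇒I (⇒E (⊢-weaken there d) (⊢-sucⁿ-cancel j (there m) (hyp (here refl))))

  all-mono : φ ⊩ ψ → all σ φ ⊩ all σ ψ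
  all-mono {σ = σ} {φ = φ} {ψ = ψ} f m d = ⇒E (⊢-weaken (⊆.∈-∷⁺ʳ m λ ()) closed) d
    where
      instance-here : (wkF (all σ φ) ∷ sInj′ ∷ []) ⊢ φ
      instance-here = subst (wkF (all σ φ) ∷ sInj′ ∷ [] ⊢_) (wk-binder-[here] φ)
                        (∀E (hyp (here refl)) (var here))

      -- in a closed context ∀I needs no renaming of the given derivation
      closed : (sInj′ ∷ []) ⊢ all σ φ ⇒ all σ ψ
      closed = ⇒I (∀I (f (there (here refl)) instance-here))

  ∀*-mono : (Δ : Ctx) {φ ψ : Formula (Δ ++ Γ)} → φ ⊩ ψ → ∀* Δ φ ⊩ ∀* Δ ψ
  ∀*-mono []      f = f
  ∀*-mono (τ ∷ Δ) f = ∀*-mono Δ (all-mono f)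

  module _ {s : Sub Γ Θ} where
    ⋁-mono : {φs : List (Formula Θ)} {ψs : List (Formula Γ)} →
             Pointwise _⊩[ s ]_ φs ψs → ⋁ φs ⊩[ s ] ⋁ ψs
    ⋁-mono []       m d = d
    ⋁-mono (p ∷ ps) m d =
      ∨E d (∨I₁ (p (there m) (hyp (here refl))))
           (∨I₂ (⋁-mono ps (there m) (hyp (here refl))))

    ⋀-mono : {φs : List (Formula Θ)} {ψs : List (Formula Γ)} →
             Pointwise _⊩[ s ]_ φs ψs → ⋀ φs ⊩[ s ] ⋀ ψs
    ⋀-mono []       m d = ⊤I
    ⋀-mono (p ∷ ps) m d = ∧I (p m (∧E₁ d)) (⋀-mono ps m (∧E₂ d))

  subF-litF : (Δ : Ctx) (s : Sub Γ Θ) (l : Lit Δ) → subF (extS* Δ s) (litF Δ l) ≡ litF Δ l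
  subF-litF Δ s (eqL t u)  = cong₂ _≐_ (sub-extS*-inl Δ s t) (sub-extS*-inl Δ s u)
  subF-litF Δ s (neqL t u) =
    cong₂ (λ a b → ¬' (a ≐ b)) (sub-extS*-inl Δ s t) (sub-extS*-inl Δ s u)

  subF-η-literal : (Δ : Ctx) (s : Sub ηCtx ηCtx) → s here ≡ sucⁿ j η → (t : Term Δ nat) →
    subF (extS* Δ s) (¬' (var (inr Δ here) ≐ ren (inl Δ) (sucⁿ j t)))
      ≡ ¬' (sucⁿ j (var (inr Δ here)) ≐ sucⁿ j (ren (inl Δ) t))
  subF-η-literal {j = j} Δ s sh t = cong₂ (λ a b → ¬' (a ≐ b))
    (extS*-inr-η Δ s sh) (trans (sub-extS*-inl Δ s (sucⁿ j t)) (ren-sucⁿ (inl Δ) j t))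

  clauseF-shift : (s : Sub ηCtx ηCtx) → s here ≡ sucⁿ j η →
                  (c : NClause) → clauseF c ⊩[ s ] clauseF (c ↓ j)
  clauseF-shift {j = j} s sh c =
    subst (clauseF c ⊩_) (sym (subF-∀* vars s _)) (∀*-mono vars (⋁-mono (++⁺ η-lits C-lits)))
    where
      open NClause c

      ηlit : Term vars nat → Formula (vars ++ ηCtx)
      ηlit t = ¬' (var (inr vars here) ≐ ren (inl vars) t)

      ηlit-shift : ∀ t → ηlit t ⊩[ extS* vars s ] ηlit (sucⁿ j t)
      ηlit-shift t {Hs} m d = subst (Hs ⊢_) (sym (subF-η-literal vars s sh t)) (≢-sucⁿ j m d)

      η-lits : Pointwise _⊩[ extS* vars s ]_ (map ηlit nlits) (map ηlit (map (sucⁿ j) nlits))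
      η-lits = subst (Pointwise _ (map ηlit nlits)) (map-∘ nlits)
                 (⊩[]-map⁺ ηlit (ηlit ∘ sucⁿ j) ηlit-shift nlits)

      C-lits : Pointwise _⊩[ extS* vars s ]_ (map (litF vars) clits) (map (litF vars) clits)
      C-lits = ⊩[]-map⁺ (litF vars) (litF vars)
                 (λ l → ⊩-reflexive (sym (subF-litF vars s l))) clits

  setF-shift : (s : Sub ηCtx ηCtx) → s here ≡ sucⁿ j η →
               (S : NClauseSet) → setF S ⊩[ s ] setF (S ↓ₛ j)
  setF-shift {j = j} s sh S = ⋀-mono (subst (Pointwise _ (map clauseF S)) (map-∘ S)
    (⊩[]-map⁺ clauseF (clauseF ∘ (_↓ j)) (clauseF-shift s sh) S))

lemma5p3 : (L : Signature) → let open FOL L in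
    (S : NClauseSet) (j : ℕ) →
    (sInj ∷ setF S ∷ []) ⊢ (setF (S ↓ₛ j)) ⟨ sucⁿ j η ⟩
lemma5p3 L S j = setF-shift L _ refl S (here refl) (FOL.hyp (there (here refl)))
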